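{- Let $G$ be an $r$-regular negative Lehman graph and $\mathcal{M}$ a perfect matching of $G$. Then the biclique expansion $e(G,\mathcal{M})$ is an $r$-regular Lehman graph with $k=1$.
   Context: A bipartite graph $G$ with $n$ black and $n$ white vertices has bipartite adjacency matrix $A$ (rows indexed by black vertices, columns by white vertices, entry $1$ iff adjacent). $G$ is an $r$-regular Lehman graph with parameter $k\in\{ -1,1,2,\ldots\}$ if $G$ is $r$-regular and there is an $n\times n$ $(0,1)$-matrix $B$ with $AB^T=J+kI$, $J$ the all-ones matrix and $I$ the identity; it is negative if $k=-1$. Biclique expansion: label the black vertices $b_1,\dots,b_n$ and white vertices $w_1,\dots,w_n$ so that $\mathcal{M}=\{b_iw_i\}$. The graph $e(G,\mathcal{M})$ has, for each $i$, a set $B_i$ of $r-1$ black vertices and a set $W_i$ of $r-1$ white vertices, with every vertex of $B_i$ joined to every vertex of $W_i$; and for each edge $b_iw_j$ of $G$ with $i\neq j$, exactly one edge between $B_i$ and $W_j$, chosen so that each vertex of each $B_i$ and of each $W_j$ is incident with exactly one such edge. (Such choices exist and all yield isomorphic graphs.) -}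

module Defs where

open import Data.Bool using (Bool; true; false; _∧_; if_then_else_)
open import Data.Nat using (ℕ; zero; suc; _+_; _*_; _∸_)
open import Data.Integer using (ℤ; +_; -[1+_]) renaming (_+_ to _+ℤ_; _≤_ to _≤ℤ_)
open import Data.Fin using (Fin; zero; suc; combine)
open import Data.Fin.Properties using (_≟_)
open import Data.Product using (_×_; ∃; _,_)
open import Data.Sum using (_⊎_)
open import Relation.Nullary using (¬_; does)
open import Relation.Binary.PropositionalEquality using (_≡_; _≢_)
open import Function.Definitions using (Injective)

⟦_⟧ : Bool → ℕ
⟦ true ⟧ = 1
⟦ false ⟧ = 0

sumFin : (n : ℕ) → (Fin n → ℕ) → ℕ
sumFin zero f = 0
sumFin (suc n) f = f zero + sumFin n (λ i → f (suc i))

count : (n : ℕ) → (Fin n → Bool) → ℕ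
count n p = sumFin n (λ i → ⟦ p i ⟧)

-- An n×n (0,1)-matrix, entries as booleans (true = 1).
-- For a bipartite adjacency matrix: rows = black vertices, columns = white vertices.
Mat01 : ℕ → Set
Mat01 n = Fin n → Fin n → Bool

Regular : (n r : ℕ) → Mat01 n → Set
Regular n r A = (∀ i → count n (λ j → A i j) ≡ r) × (∀ j → count n (λ i → A i j) ≡ r)

prodT : (n : ℕ) → Mat01 n → Mat01 n → Fin n → Fin n → ℕ
prodT n A B i j = count n (λ l → A i l ∧ B j l)

ValidParam : ℤ → Set
ValidParam k = (k ≡ -[1+ 0 ]) ⊎ (+ 1 ≤ℤ k)

ProdIsJplusKI : (n : ℕ) → ℤ → Mat01 n → Mat01 n → Set
ProdIsJplusKI n k A B =
  ∀ i j → + (prodT n A B i j) ≡ (if does (i ≟ j) then + 1 +ℤ k else + 1)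

IsLehman : (n r : ℕ) → ℤ → Mat01 n → Set
IsLehman n r k A = Regular n r A × ValidParam k × ∃ (λ B → ProdIsJplusKI n k A B)

-- A perfect matching of G: black vertex i is matched to white vertex m i;
-- m is injective (hence a bijection of Fin n) and each b_i w_{m i} is an edge.
IsPerfectMatching : (n : ℕ) → Mat01 n → (Fin n → Fin n) → Set
IsPerfectMatching n A m = Injective _≡_ _≡_ m × (∀ i → A i (m i) ≡ true)

count2 : (s : ℕ) → (Fin s → Fin s → Bool) → ℕ
count2 s p = sumFin s (λ a → count s (λ b → p a b))

-- Vertex sets: black vertex (i , a) ∈ B_i and white vertex (w , b) ∈ W_w are encoded
-- as `combine i a` and `combine w b` in Fin (n * (r ∸ 1)), a, b : Fin (r ∸ 1).
-- Here W_w is the copy set for the ORIGINAL white vertex w (so the biclique on B_i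
-- is with W_{m i}, i.e. with the part of the matched partner of b_i).
-- H is any graph satisfying the construction (all choices give isomorphic graphs).
IsBicliqueExpansion : (n r : ℕ) → Mat01 n → (Fin n → Fin n) → Mat01 (n * (r ∸ 1)) → Set
IsBicliqueExpansion n r A m H =
  (∀ i a b → H (combine i a) (combine (m i) b) ≡ true)
  × (∀ i w → w ≢ m i →
       count2 s (λ a b → H (combine i a) (combine w b)) ≡ ⟦ A i w ⟧)
  × (∀ i a → sumFin n (λ w → if does (w ≟ m i) then 0
                               else count s (λ b → H (combine i a) (combine w b))) ≡ 1)
  × (∀ w b → sumFin n (λ i → if does (m i ≟ w) then 0
                               else count s (λ a → H (combine i a) (combine w b))) ≡ 1)
  where
  s : ℕ
  s = r ∸ 1

-- Lehman's theorem for the negative case: if A is regular and A Bᵀ = J − I, then also Bᵀ A = J − I.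
-- Over ℕ we argue modulo M = 2n − 1, where J − I is invertible because n − 1 is.  Then A Bᵀ is
-- injective mod M, hence so is Bᵀ, hence Bᵀ is also surjective mod M (there are finitely many
-- vectors mod M), and so A is injective mod M.  As A (Bᵀ A) = (J − I) A = A (J − I) and all entries
-- of Bᵀ A and J − I are below M, Bᵀ A = J − I.
--
-- The expansion H is the union of the bicliques B_i × W_{m i} and a perfect matching x ↦ mate x of
-- external edges, which joins a copy in B_j to W_w exactly when b_j w_w is a non-matching edge of G.
-- Take B' x' y = [y = mate x'] ∨ B (block (mate⁻¹ y)) t, where t is the block of mate x'.  For
-- x ∈ B_i, in (H B'ᵀ) x x' the matching contributes δ x x' + B i t and the biclique contributes
-- [t = m i] + Σ_j (A j (m i) − δ j i) B j t; the total is δ x x' + [t = m i] + (Bᵀ A) t (m i) = 1 + δ x x'.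
module Submission where

open import Data.Bool using (Bool; true; false; _∧_; _∨_; not; if_then_else_)
open import Data.Bool.Properties using (∧-zeroʳ; ∧-identityʳ)
open import Data.Nat using (ℕ; zero; suc; _+_; _*_; _∸_; _^_; pred; _≤_; _<_; z≤n; s≤s; NonZero; _%_)
open import Data.Nat.Properties hiding (_≟_)
open import Data.Nat.DivMod using (_mod_; %-distribˡ-+; %-distribˡ-*; [m+kn]%n≡m%n; m<n⇒m%n≡m; m%n<n)
open import Data.Nat.Tactic.RingSolver using (solve-∀)
open import Data.Fin
  using (Fin; zero; suc; toℕ; combine; quotient; remainder; _↑ˡ_; _↑ʳ_; punchOut; funToFin; finToFun)
open import Data.Fin.Properties
  using (_≟_; any?; toℕ-injective; toℕ<n; toℕ-fromℕ<; punchOut-injective; injective⇒≤;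
         funToFin-finToFin; finToFun-funToFin; remQuot-combine; combine-remQuot)
open import Data.Product using (∃; ∃!; _,_; proj₁; proj₂)
open import Data.Sum using (inj₂)
open import Data.Vec.Functional using (Vector)
open import Function using (_∘_)
open import Function.Definitions using (Injective)
open import Relation.Nullary using (¬_; Dec; does; yes; no; contradiction)
open import Relation.Binary.PropositionalEquality
open import Algebra.Properties.Semiring.Sum +-*-semiring

open import Defs

-- Finite sums

sumFin≡∑ : ∀ n (f : Vector ℕ n) → sumFin n f ≡ ∑[ i < n ] f i
sumFin≡∑ zero    f = refl
sumFin≡∑ (suc n) f = cong (f zero +_) (sumFin≡∑ n (f ∘ suc))

count≡∑ : ∀ n (p : Fin n → Bool) → count n p ≡ ∑[ i < n ] ⟦ p i ⟧
count≡∑ n p = sumFin≡∑ n (λ i → ⟦ p i ⟧)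

∑-const : ∀ n c → ∑[ i < n ] c ≡ n * c
∑-const zero    c = refl
∑-const (suc n) c = cong (c +_) (∑-const n c)

∑-↑ : ∀ a b (f : Vector ℕ (a + b)) →
      ∑[ y < a + b ] f y ≡ ∑[ i < a ] f (i ↑ˡ b) + ∑[ j < b ] f (a ↑ʳ j)
∑-↑ zero    b f = refl
∑-↑ (suc a) b f = trans (cong (f zero +_) (∑-↑ a b (f ∘ suc))) (sym (+-assoc (f zero) _ _))

∑-combine : ∀ n s (f : Vector ℕ (n * s)) →
            ∑[ y < n * s ] f y ≡ ∑[ i < n ] ∑[ a < s ] f (combine i a)
∑-combine zero    s f = refl
∑-combine (suc n) s f =
  trans (∑-↑ s (n * s) f) (cong (∑[ a < s ] f (a ↑ˡ (n * s)) +_) (∑-combine n s (f ∘ (s ↑ʳ_))))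

∑-expand : ∀ {n} (a b c d : Vector ℕ n) →
           ∑[ y < n ] ((a y + b y) * (c y + d y)) ≡
           ∑[ y < n ] (a y * c y) + ∑[ y < n ] (a y * d y) + (∑[ y < n ] (b y * c y) + ∑[ y < n ] (b y * d y))
∑-expand {n} a b c d = begin
  ∑[ y < n ] ((a y + b y) * (c y + d y))
    ≡⟨ sum-cong-≗ (λ y → distrib (a y) (b y) (c y) (d y)) ⟩
  ∑[ y < n ] ((a y * c y + a y * d y) + (b y * c y + b y * d y))
    ≡⟨ ∑-distrib-+ (λ y → a y * c y + a y * d y) (λ y → b y * c y + b y * d y) ⟩
  ∑[ y < n ] (a y * c y + a y * d y) + ∑[ y < n ] (b y * c y + b y * d y)
    ≡⟨ cong₂ _+_ (∑-distrib-+ (λ y → a y * c y) (λ y → a y * d y))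
                 (∑-distrib-+ (λ y → b y * c y) (λ y → b y * d y)) ⟩
  ∑[ y < n ] (a y * c y) + ∑[ y < n ] (a y * d y) + (∑[ y < n ] (b y * c y) + ∑[ y < n ] (b y * d y)) ∎
  where
  open ≡-Reasoning
  distrib : ∀ a b c d → (a + b) * (c + d) ≡ (a * c + a * d) + (b * c + b * d)
  distrib = solve-∀

∑≡0⇒≡0 : ∀ {n} (f : Vector ℕ n) → ∑[ i < n ] f i ≡ 0 → ∀ i → f i ≡ 0
∑≡0⇒≡0 f ∑f≡0 zero    = m+n≡0⇒m≡0 (f zero) ∑f≡0
∑≡0⇒≡0 f ∑f≡0 (suc i) = ∑≡0⇒≡0 (f ∘ suc) (m+n≡0⇒n≡0 (f zero) ∑f≡0) i

∑≤n : ∀ {n} (f : Vector ℕ n) → (∀ i → f i ≤ 1) → ∑[ i < n ] f i ≤ n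
∑≤n {zero}  f f≤1 = z≤n
∑≤n {suc n} f f≤1 = +-mono-≤ (f≤1 zero) (∑≤n (f ∘ suc) (f≤1 ∘ suc))

⟦⟧≤1 : ∀ b → ⟦ b ⟧ ≤ 1
⟦⟧≤1 false = z≤n
⟦⟧≤1 true  = s≤s z≤n

⟦∧⟧ : ∀ a b → ⟦ a ∧ b ⟧ ≡ ⟦ a ⟧ * ⟦ b ⟧
⟦∧⟧ false b = refl
⟦∧⟧ true  b = sym (+-identityʳ ⟦ b ⟧)

⟦⟧*⟦⟧≤1 : ∀ a b → ⟦ a ⟧ * ⟦ b ⟧ ≤ 1
⟦⟧*⟦⟧≤1 a b = subst (_≤ 1) (⟦∧⟧ a b) (⟦⟧≤1 (a ∧ b))

⟦⟧≡0⇒false : ∀ {b} → ⟦ b ⟧ ≡ 0 → b ≡ false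
⟦⟧≡0⇒false {false} _ = refl

count≤n : ∀ n (p : Fin n → Bool) → count n p ≤ n
count≤n n p = subst (_≤ n) (sym (count≡∑ n p)) (∑≤n (λ i → ⟦ p i ⟧) (⟦⟧≤1 ∘ p))

∑-∧-not : ∀ {s} c (g : Fin s → Bool) → ∑[ b < s ] ⟦ g b ∧ not c ⟧ ≡ (if c then 0 else count s g)
∑-∧-not {s} true  g = trans (sum-cong-≗ (λ b → cong ⟦_⟧ (∧-zeroʳ (g b)))) (sum-replicate-zero s)
∑-∧-not {s} false g = trans (sum-cong-≗ (λ b → cong ⟦_⟧ (∧-identityʳ (g b)))) (sym (count≡∑ s g))

δ : ∀ {n} → Fin n → Fin n → ℕ
δ i j = ⟦ does (i ≟ j) ⟧

does-≟-sym : ∀ {n} (i j : Fin n) → does (i ≟ j) ≡ does (j ≟ i)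
does-≟-sym i j with i ≟ j | j ≟ i
... | yes _    | yes _    = refl
... | no  _    | no  _    = refl
... | yes i≡j  | no  j≢i  = contradiction (sym i≡j) j≢i
... | no  i≢j  | yes j≡i  = contradiction (sym j≡i) i≢j

δ-sym : ∀ {n} (i j : Fin n) → δ i j ≡ δ j i
δ-sym i j = cong ⟦_⟧ (does-≟-sym i j)

δ-injective : ∀ {n k} {f : Fin n → Fin k} → Injective _≡_ _≡_ f → ∀ i j → δ (f i) (f j) ≡ δ i j
δ-injective {f = f} f-inj i j with i ≟ j | f i ≟ f j
... | yes _    | yes _     = refl
... | no  _    | no  _     = refl
... | yes refl | no  fi≢fi = contradiction refl fi≢fi
... | no  i≢j  | yes fi≡fj = contradiction (f-inj fi≡fj) i≢j

∑-δ : ∀ {n} (k : Fin n) (f : Vector ℕ n) → ∑[ j < n ] (δ j k * f j) ≡ f k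
∑-δ {suc n} zero    f = trans (cong₂ _+_ (+-identityʳ (f zero)) (sum-replicate-zero n)) (+-identityʳ (f zero))
∑-δ {suc n} (suc k) f = ∑-δ k (f ∘ suc)

∑-δʳ : ∀ {n} (k : Fin n) (f : Vector ℕ n) → ∑[ j < n ] (f j * δ j k) ≡ f k
∑-δʳ k f = trans (sum-cong-≗ (λ j → *-comm (f j) (δ j k))) (∑-δ k f)

∑⟦⟧≡1⇒∃! : ∀ {n} (p : Fin n → Bool) → ∑[ i < n ] ⟦ p i ⟧ ≡ 1 → ∃! _≡_ (λ i → p i ≡ true)
∑⟦⟧≡1⇒∃! {suc n} p ∑p≡1 with p zero in p₀
... | true  = zero , p₀ , only-zero
  where
  only-zero : ∀ {i} → p i ≡ true → zero ≡ i
  only-zero {zero}  _       = refl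
  only-zero {suc i} pᵢ≡true =
    contradiction (subst (λ b → ⟦ b ⟧ ≡ 0) pᵢ≡true (∑≡0⇒≡0 (λ j → ⟦ p (suc j) ⟧) (suc-injective ∑p≡1) i)) λ ()
... | false with ∑⟦⟧≡1⇒∃! (p ∘ suc) ∑p≡1
...   | i , pᵢ , unique = suc i , pᵢ , only-suc-i
  where
  only-suc-i : ∀ {j} → p j ≡ true → suc i ≡ j
  only-suc-i {zero}  p₀≡true = contradiction (trans (sym p₀) p₀≡true) λ ()
  only-suc-i {suc j} pⱼ      = cong suc (unique pⱼ)

∃!⇒⟦⟧≡δ : ∀ {n} (p : Fin n → Bool) (u : ∃! _≡_ (λ i → p i ≡ true)) → ∀ i → ⟦ p i ⟧ ≡ δ i (proj₁ u)
∃!⇒⟦⟧≡δ p (i₀ , pᵢ₀ , unique) i with i ≟ i₀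
... | yes refl = cong ⟦_⟧ pᵢ₀
... | no  i≢i₀ with p i in pᵢ
...   | true  = contradiction (sym (unique pᵢ)) i≢i₀
...   | false = refl

-- Injective maps between finite sets

injective⇒surjective : ∀ {N} (f : Fin N → Fin N) → Injective _≡_ _≡_ f → ∀ t → ∃ λ k → f k ≡ t
injective⇒surjective {suc N} f f-inj t with any? (λ k → f k ≟ t)
... | yes hit  = hit
... | no  miss = contradiction (injective⇒≤ punched-inj) 1+n≰n
  where
  punched : Fin (suc N) → Fin N
  punched k = punchOut {i = t} {j = f k} (λ t≡fk → miss (k , sym t≡fk))
  punched-inj : Injective _≡_ _≡_ punched
  punched-inj eq = f-inj (punchOut-injective {i = t} _ _ eq)

funToFin-cong : ∀ {k M} {f g : Fin k → Fin M} → f ≗ g → funToFin f ≡ funToFin g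
funToFin-cong {zero}  _   = refl
funToFin-cong {suc k} f≗g = cong₂ combine (f≗g zero) (funToFin-cong (f≗g ∘ suc))

funToFin-injective : ∀ {k M} {f g : Fin k → Fin M} → funToFin f ≡ funToFin g → f ≗ g
funToFin-injective {f = f} {g} eq l =
  trans (sym (finToFun-funToFin f l)) (trans (cong (λ c → finToFun c l) eq) (finToFun-funToFin g l))

≗-injective⇒surjective : ∀ {k M} (g : (Fin k → Fin M) → (Fin k → Fin M)) →
                         (∀ y y' → g y ≗ g y' → y ≗ y') → ∀ z → ∃ λ y → g y ≗ z
≗-injective⇒surjective {k} {M} g g-inj z =
  let (c , Gc≡z) = injective⇒surjective G G-inj (encode z) in
  decode c , funToFin-injective Gc≡z
  where
  encode : (Fin k → Fin M) → Fin (M ^ k)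
  encode = funToFin
  decode : Fin (M ^ k) → (Fin k → Fin M)
  decode = finToFun
  G : Fin (M ^ k) → Fin (M ^ k)
  G c = encode (g (decode c))
  G-inj : Injective _≡_ _≡_ G
  G-inj {c} {c'} eq = begin
    c                   ≡⟨ funToFin-finToFin {k} {M} c ⟨
    encode (decode c)   ≡⟨ funToFin-cong (g-inj _ _ (funToFin-injective eq)) ⟩
    encode (decode c')  ≡⟨ funToFin-finToFin {k} {M} c' ⟩
    c'                  ∎
    where open ≡-Reasoning

-- Congruence modulo M

module _ (M : ℕ) .{{_ : NonZero M}} where

  %-cong-+ : ∀ {a b c d} → a % M ≡ b % M → c % M ≡ d % M → (a + c) % M ≡ (b + d) % M
  %-cong-+ {a} {b} {c} {d} a≡b c≡d = begin
    (a + c) % M          ≡⟨ %-distribˡ-+ a c M ⟩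
    (a % M + c % M) % M  ≡⟨ cong₂ (λ u v → (u + v) % M) a≡b c≡d ⟩
    (b % M + d % M) % M  ≡⟨ %-distribˡ-+ b d M ⟨
    (b + d) % M          ∎
    where open ≡-Reasoning

  %-cong-*ˡ : ∀ c {a b} → a % M ≡ b % M → (c * a) % M ≡ (c * b) % M
  %-cong-*ˡ c {a} {b} a≡b = begin
    (c * a) % M            ≡⟨ %-distribˡ-* c a M ⟩
    (c % M * (a % M)) % M  ≡⟨ cong (λ u → (c % M * u) % M) a≡b ⟩
    (c % M * (b % M)) % M  ≡⟨ %-distribˡ-* c b M ⟨
    (c * b) % M            ∎
    where open ≡-Reasoning

  %-cong-∑ : ∀ {n} {f g : Vector ℕ n} → (∀ i → f i % M ≡ g i % M) →
             (∑[ i < n ] f i) % M ≡ (∑[ i < n ] g i) % M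
  %-cong-∑ {zero}  f≡g = refl
  %-cong-∑ {suc n} f≡g = %-cong-+ (f≡g zero) (%-cong-∑ (f≡g ∘ suc))

  +-cancelˡ-% : ∀ c {a b} → (c + a) % M ≡ (c + b) % M → a % M ≡ b % M
  +-cancelˡ-% c {a} {b} ca≡cb = begin
    a % M                     ≡⟨ [m+kn]%n≡m%n a c M ⟨
    (a + c * M) % M           ≡⟨ cong (_% M) (shift a) ⟩
    (c + a + c * pred M) % M  ≡⟨ %-cong-+ ca≡cb refl ⟩
    (c + b + c * pred M) % M  ≡⟨ cong (_% M) (shift b) ⟨
    (b + c * M) % M           ≡⟨ [m+kn]%n≡m%n b c M ⟩
    b % M                     ∎
    where
    open ≡-Reasoning
    rearrange : ∀ x c μ → x + c * suc μ ≡ c + x + c * μ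
    rearrange = solve-∀
    shift : ∀ x → x + c * M ≡ c + x + c * pred M
    shift x = trans (cong (λ μ → x + c * μ) (sym (suc-pred M))) (rearrange x c (pred M))

  %≡%⇒≡ : ∀ {a b} → a < M → b < M → a % M ≡ b % M → a ≡ b
  %≡%⇒≡ a<M b<M a≡b = trans (sym (m<n⇒m%n≡m a<M)) (trans a≡b (m<n⇒m%n≡m b<M))

inverse-mod-1+2n : ∀ n → (n * (n + pred n)) % suc (n + n) ≡ 1 % suc (n + n)
inverse-mod-1+2n zero    = refl
inverse-mod-1+2n (suc k) = trans (cong (_% M) (inverse k)) ([m+kn]%n≡m%n 1 k M)
  where
  M : ℕ
  M = suc (suc k + suc k)
  inverse : ∀ k → suc k * (suc k + k) ≡ 1 + k * suc (suc k + suc k)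
  inverse = solve-∀

CongruentMod : ∀ {n} (M : ℕ) .{{_ : NonZero M}} → Vector ℕ n → Vector ℕ n → Set
CongruentMod M u v = ∀ i → u i % M ≡ v i % M

InjectiveMod : ∀ {n} (M : ℕ) .{{_ : NonZero M}} → (Vector ℕ n → Vector ℕ n) → Set
InjectiveMod M f = ∀ u v → CongruentMod M (f u) (f v) → CongruentMod M u v

injectiveMod⇒surjectiveMod : ∀ {n M} .{{_ : NonZero M}} (f : Vector ℕ n → Vector ℕ n) →
                             InjectiveMod M f → ∀ x → ∃ λ u → CongruentMod M (f u) x
injectiveMod⇒surjectiveMod {n} {M} f f-inj x =
  let (y , gy≗x) = ≗-injective⇒surjective g g-inj (reduce x) in
  toℕ ∘ y , mod≡⇒%≡ ∘ gy≗x
  where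
  reduce : Vector ℕ n → Fin n → Fin M
  reduce v i = v i mod M
  mod≡⇒%≡ : ∀ {a b} → a mod M ≡ b mod M → a % M ≡ b % M
  mod≡⇒%≡ {a} {b} eq =
    trans (sym (toℕ-fromℕ< (m%n<n a M))) (trans (cong toℕ eq) (toℕ-fromℕ< (m%n<n b M)))
  g : (Fin n → Fin M) → Fin n → Fin M
  g y = reduce (f (toℕ ∘ y))
  g-inj : ∀ y y' → g y ≗ g y' → y ≗ y'
  g-inj y y' gy≗gy' i = toℕ-injective (begin
    toℕ (y i)       ≡⟨ m<n⇒m%n≡m (toℕ<n (y i)) ⟨
    toℕ (y i) % M   ≡⟨ f-inj _ _ (mod≡⇒%≡ ∘ gy≗gy') i ⟩
    toℕ (y' i) % M  ≡⟨ m<n⇒m%n≡m (toℕ<n (y' i)) ⟩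
    toℕ (y' i)      ∎)
    where open ≡-Reasoning

-- Matrices over ℕ

Matrix : ℕ → Set
Matrix n = Fin n → Fin n → ℕ

infix  10 _ᵀ
infixl 7 _·_ _⊙_

_ᵀ : ∀ {n} → Matrix n → Matrix n
(P ᵀ) i j = P j i

_·_ : ∀ {n} → Matrix n → Matrix n → Matrix n
_·_ {n} P Q i k = ∑[ j < n ] (P i j * Q j k)

_⊙_ : ∀ {n} → Matrix n → Vector ℕ n → Vector ℕ n
_⊙_ {n} P v i = ∑[ j < n ] (P i j * v j)

⟪_⟫ : ∀ {n} → Mat01 n → Matrix n
⟪ A ⟫ i j = ⟦ A i j ⟧

prodT≡· : ∀ {n} (A B : Mat01 n) i j → prodT n A B i j ≡ (⟪ A ⟫ · ⟪ B ⟫ ᵀ) i j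
prodT≡· {n} A B i j = trans (count≡∑ n (λ l → A i l ∧ B j l)) (sum-cong-≗ (λ l → ⟦∧⟧ (A i l) (B j l)))

⊙-cong : ∀ {n} {P Q : Matrix n} → (∀ i j → P i j ≡ Q i j) → ∀ v i → (P ⊙ v) i ≡ (Q ⊙ v) i
⊙-cong P≡Q v i = sum-cong-≗ (λ j → cong (_* v j) (P≡Q i j))

⊙-assoc : ∀ {n} (P Q : Matrix n) v i → (P ⊙ (Q ⊙ v)) i ≡ ((P · Q) ⊙ v) i
⊙-assoc {n} P Q v i = begin
  ∑[ j < n ] (P i j * ∑[ k < n ] (Q j k * v k))
    ≡⟨ sum-cong-≗ (λ j → *-distribˡ-sum (P i j) (λ k → Q j k * v k)) ⟩
  ∑[ j < n ] ∑[ k < n ] (P i j * (Q j k * v k))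
    ≡⟨ ∑-comm (λ j k → P i j * (Q j k * v k)) ⟩
  ∑[ k < n ] ∑[ j < n ] (P i j * (Q j k * v k))
    ≡⟨ sum-cong-≗ regroup ⟩
  ∑[ k < n ] (∑[ j < n ] (P i j * Q j k) * v k)
    ∎
  where
  open ≡-Reasoning
  regroup : ∀ k → ∑[ j < n ] (P i j * (Q j k * v k)) ≡ ∑[ j < n ] (P i j * Q j k) * v k
  regroup k = trans (sum-cong-≗ (λ j → sym (*-assoc (P i j) (Q j k) (v k))))
                    (sym (*-distribʳ-sum (v k) (λ j → P i j * Q j k)))

⊙-congMod : ∀ {n M} .{{_ : NonZero M}} (P : Matrix n) {u v : Vector ℕ n} →
            CongruentMod M u v → CongruentMod M (P ⊙ u) (P ⊙ v)
⊙-congMod {M = M} P u≡v i = %-cong-∑ M (λ j → %-cong-*ˡ M (P i j) (u≡v j))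

-- Q ⊙_ is injective, hence (there being finitely many vectors mod M) surjective, modulo M:
-- this is what turns the right inverse Q of P into a left inverse.
·-injectiveMod⇒injectiveModˡ : ∀ {n M} .{{_ : NonZero M}} (P Q : Matrix n) →
                               InjectiveMod M ((P · Q) ⊙_) → InjectiveMod M (P ⊙_)
·-injectiveMod⇒injectiveModˡ {M = M} P Q PQ-inj x x' Px≡Px' i =
  let (u  , Qu≡x)   = injectiveMod⇒surjectiveMod (Q ⊙_) Q-inj x
      (u' , Qu'≡x') = injectiveMod⇒surjectiveMod (Q ⊙_) Q-inj x'
      PQu≡PQu' j    = trans (⊙-congMod P Qu≡x j) (trans (Px≡Px' j) (sym (⊙-congMod P Qu'≡x' j)))
  in trans (sym (Qu≡x i)) (trans (⊙-congMod Q (via-PQ PQu≡PQu') i) (Qu'≡x' i))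
  where
  via-PQ : ∀ {u v} → CongruentMod M (P ⊙ (Q ⊙ u)) (P ⊙ (Q ⊙ v)) → CongruentMod M u v
  via-PQ {u} {v} eq = PQ-inj u v (λ j →
    trans (cong (_% M) (sym (⊙-assoc P Q u j))) (trans (eq j) (cong (_% M) (⊙-assoc P Q v j))))
  Q-inj : InjectiveMod M (Q ⊙_)
  Q-inj u v Qu≡Qv = via-PQ (⊙-congMod P Qu≡Qv)

J∸I : ∀ {n} → Matrix n
J∸I i j = ⟦ not (does (i ≟ j)) ⟧

J∸I+δ : ∀ {n} (i j : Fin n) → J∸I i j + δ i j ≡ 1
J∸I+δ i j with does (i ≟ j)
... | true  = refl
... | false = refl

J∸I-diagonal : ∀ {n} (i : Fin n) → J∸I i i ≡ 0
J∸I-diagonal i with i ≟ i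
... | yes _   = refl
... | no  i≢i = contradiction refl i≢i

J∸I-sym : ∀ {n} (i j : Fin n) → J∸I i j ≡ J∸I j i
J∸I-sym i j = +-cancelʳ-≡ (δ i j) (J∸I i j) (J∸I j i)
  (trans (J∸I+δ i j) (sym (trans (cong (J∸I j i +_) (δ-sym i j)) (J∸I+δ j i))))

J∸I-⊙ : ∀ {n} (v : Vector ℕ n) i → (J∸I ⊙ v) i + v i ≡ ∑[ j < n ] v j
J∸I-⊙ {n} v i = begin
  (J∸I ⊙ v) i + v i                         ≡⟨ cong ((J∸I ⊙ v) i +_) (∑-δ i v) ⟨
  (J∸I ⊙ v) i + ∑[ j < n ] (δ j i * v j)    ≡⟨ ∑-distrib-+ (λ j → J∸I i j * v j) (λ j → δ j i * v j) ⟨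
  ∑[ j < n ] (J∸I i j * v j + δ j i * v j)  ≡⟨ sum-cong-≗ collapse ⟩
  ∑[ j < n ] v j                            ∎
  where
  open ≡-Reasoning
  collapse : ∀ j → J∸I i j * v j + δ j i * v j ≡ v j
  collapse j = begin
    J∸I i j * v j + δ j i * v j  ≡⟨ *-distribʳ-+ (v j) (J∸I i j) (δ j i) ⟨
    (J∸I i j + δ j i) * v j      ≡⟨ cong (λ d → (J∸I i j + d) * v j) (δ-sym j i) ⟩
    (J∸I i j + δ i j) * v j      ≡⟨ cong (_* v j) (J∸I+δ i j) ⟩
    1 * v j                      ≡⟨ *-identityˡ (v j) ⟩
    v j                          ∎

-- Summing (J − I) u = (∑ u) − u over the coordinates gives (n − 1) ∑ u, and c inverts n − 1.
J∸I-injectiveMod : ∀ {n' M} .{{_ : NonZero M}} c → (n' * c) % M ≡ 1 % M →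
                   InjectiveMod M (J∸I {suc n'} ⊙_)
J∸I-injectiveMod {n'} {M} c n'c≡1 u v Ju≡Jv i = +-cancelˡ-% M S (begin
  (S + u i) % M  ≡⟨ %-cong-+ M S≡T refl ⟩
  (T + u i) % M  ≡⟨ crossed i ⟨
  (S + v i) % M  ∎)
  where
  open ≡-Reasoning
  S : ℕ
  S = ∑[ j < suc n' ] u j
  T : ℕ
  T = ∑[ j < suc n' ] v j
  peel : ∀ (w : Vector ℕ (suc n')) j z → ∑[ k < suc n' ] w k + z ≡ (J∸I ⊙ w) j + (w j + z)
  peel w j z = trans (cong (_+ z) (sym (J∸I-⊙ w j))) (+-assoc ((J∸I ⊙ w) j) (w j) z)
  crossed : ∀ j → (S + v j) % M ≡ (T + u j) % M
  crossed j = begin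
    (S + v j) % M                    ≡⟨ cong (_% M) (peel u j (v j)) ⟩
    ((J∸I ⊙ u) j + (u j + v j)) % M  ≡⟨ %-cong-+ M (Ju≡Jv j) (cong (_% M) (+-comm (u j) (v j))) ⟩
    ((J∸I ⊙ v) j + (v j + u j)) % M  ≡⟨ cong (_% M) (peel v j (u j)) ⟨
    (T + u j) % M                    ∎
  rearrange : ∀ X Y → ∑[ j < suc n' ] X + Y ≡ X + Y + n' * X
  rearrange X Y = trans (cong (_+ Y) (∑-const (suc n') X)) (shuffle X Y n')
    where
    shuffle : ∀ X Y n' → suc n' * X + Y ≡ X + Y + n' * X
    shuffle = solve-∀
  n'S≡n'T : (n' * S) % M ≡ (n' * T) % M
  n'S≡n'T = +-cancelˡ-% M (S + T) (begin
    (S + T + n' * S) % M             ≡⟨ cong (_% M) (rearrange S T) ⟨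
    (∑[ j < suc n' ] S + T) % M      ≡⟨ cong (_% M) (∑-distrib-+ (λ _ → S) v) ⟨
    (∑[ j < suc n' ] (S + v j)) % M  ≡⟨ %-cong-∑ M crossed ⟩
    (∑[ j < suc n' ] (T + u j)) % M  ≡⟨ cong (_% M) (∑-distrib-+ (λ _ → T) u) ⟩
    (∑[ j < suc n' ] T + S) % M      ≡⟨ cong (_% M) (rearrange T S) ⟩
    (T + S + n' * T) % M             ≡⟨ cong (λ z → (z + n' * T) % M) (+-comm T S) ⟩
    (S + T + n' * T) % M             ∎)
  cancel-n' : ∀ X → (c * (n' * X)) % M ≡ X % M
  cancel-n' X = begin
    (c * (n' * X)) % M  ≡⟨ cong (_% M) (swap c n' X) ⟩
    (X * (n' * c)) % M  ≡⟨ %-cong-*ˡ M X n'c≡1 ⟩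
    (X * 1) % M         ≡⟨ cong (_% M) (*-identityʳ X) ⟩
    X % M               ∎
    where
    swap : ∀ c n' X → c * (n' * X) ≡ X * (n' * c)
    swap = solve-∀
  S≡T : S % M ≡ T % M
  S≡T = trans (sym (cancel-n' S)) (trans (%-cong-*ˡ M c n'S≡n'T) (cancel-n' T))

J∸I·≡·J∸I : ∀ {n r} (A : Mat01 n) → Regular n r A → ∀ i w → (J∸I · ⟪ A ⟫) i w ≡ (⟪ A ⟫ · J∸I) i w
J∸I·≡·J∸I {n} {r} A (rowA , colA) i w = +-cancelʳ-≡ ⟦ A i w ⟧ _ _ (begin
  (J∸I · ⟪ A ⟫) i w + ⟦ A i w ⟧        ≡⟨ J∸I-⊙ (λ j → ⟦ A j w ⟧) i ⟩
  ∑[ j < n ] ⟦ A j w ⟧                 ≡⟨ trans (sym (count≡∑ n (λ j → A j w))) (colA w) ⟩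
  r                                    ≡⟨ trans (sym (count≡∑ n (A i))) (rowA i) ⟨
  ∑[ l < n ] ⟦ A i l ⟧                 ≡⟨ J∸I-⊙ (⟪ A ⟫ i) w ⟨
  (J∸I ⊙ ⟪ A ⟫ i) w + ⟦ A i w ⟧        ≡⟨ cong (_+ ⟦ A i w ⟧) (sum-cong-≗ transposed) ⟩
  (⟪ A ⟫ · J∸I) i w + ⟦ A i w ⟧        ∎)
  where
  open ≡-Reasoning
  transposed : ∀ l → J∸I w l * ⟦ A i l ⟧ ≡ ⟦ A i l ⟧ * J∸I l w
  transposed l = trans (*-comm (J∸I w l) ⟦ A i l ⟧) (cong (⟦ A i l ⟧ *_) (J∸I-sym w l))

-- Lehman's theorem for J − I

·ᵀ≡J∸I⇒injectiveMod : ∀ {n'} (A B : Matrix (suc n')) → (∀ i j → (A · B ᵀ) i j ≡ J∸I i j) →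
                      InjectiveMod (suc (n' + n')) (A ⊙_)
·ᵀ≡J∸I⇒injectiveMod {n'} A B ABᵀ≡J∸I = ·-injectiveMod⇒injectiveModˡ A (B ᵀ) λ u v ABᵀu≡ABᵀv →
  J∸I-injectiveMod (n' + pred n') (inverse-mod-1+2n n') u v λ i → begin
    (J∸I ⊙ u) i % M      ≡⟨ cong (_% M) (⊙-cong ABᵀ≡J∸I u i) ⟨
    (A · B ᵀ ⊙ u) i % M  ≡⟨ ABᵀu≡ABᵀv i ⟩
    (A · B ᵀ ⊙ v) i % M  ≡⟨ cong (_% M) (⊙-cong ABᵀ≡J∸I v i) ⟩
    (J∸I ⊙ v) i % M      ∎
  where
  open ≡-Reasoning
  M : ℕ
  M = suc (n' + n')

·ᵀ≡J∸I⇒ᵀ·≡J∸I : ∀ {n r} (A B : Mat01 n) → 2 ≤ n → Regular n r A →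
                (∀ i j → (⟪ A ⟫ · ⟪ B ⟫ ᵀ) i j ≡ J∸I i j) →
                ∀ l w → (⟪ B ⟫ ᵀ · ⟪ A ⟫) l w ≡ J∸I l w
·ᵀ≡J∸I⇒ᵀ·≡J∸I {suc (suc k)} A B (s≤s (s≤s z≤n)) regular ABᵀ≡J∸I l w =
  %≡%⇒≡ M (≤-<-trans (∑≤n (λ j → ⟦ B j l ⟧ * ⟦ A j w ⟧) (λ j → ⟦⟧*⟦⟧≤1 (B j l) (A j w))) n<M)
          (≤-<-trans (⟦⟧≤1 _) (s≤s (s≤s z≤n)))
          (·ᵀ≡J∸I⇒injectiveMod ⟪ A ⟫ ⟪ B ⟫ ABᵀ≡J∸I (λ l → (⟪ B ⟫ ᵀ · ⟪ A ⟫) l w) (λ l → J∸I l w)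
            (λ i → cong (_% M) (same-image i)) l)
  where
  n : ℕ
  n = suc (suc k)
  M : ℕ
  M = suc (suc k + suc k)
  n<M : n < M
  n<M = s≤s (s≤s (m≤n+m (suc k) k))
  same-image : ∀ i → (⟪ A ⟫ · (⟪ B ⟫ ᵀ · ⟪ A ⟫)) i w ≡ (⟪ A ⟫ · J∸I) i w
  same-image i = begin
    (⟪ A ⟫ · (⟪ B ⟫ ᵀ · ⟪ A ⟫)) i w  ≡⟨ ⊙-assoc ⟪ A ⟫ (⟪ B ⟫ ᵀ) (λ j → ⟦ A j w ⟧) i ⟩
    ((⟪ A ⟫ · ⟪ B ⟫ ᵀ) · ⟪ A ⟫) i w  ≡⟨ ⊙-cong ABᵀ≡J∸I (λ j → ⟦ A j w ⟧) i ⟩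
    (J∸I · ⟪ A ⟫) i w                ≡⟨ J∸I·≡·J∸I A regular i w ⟩
    (⟪ A ⟫ · J∸I) i w                ∎
    where open ≡-Reasoning

-- The biclique expansion

module BicliqueExpansion {n s : ℕ} (A : Mat01 n) (m : Fin n → Fin n) (H : Mat01 (n * s))
  (matching : IsPerfectMatching n A m) (expansion : IsBicliqueExpansion n (suc s) A m H)
  where

  m-injective : Injective _≡_ _≡_ m
  m-injective = proj₁ matching

  m-edge : ∀ i → A i (m i) ≡ true
  m-edge = proj₂ matching

  biclique : ∀ i a b → H (combine i a) (combine (m i) b) ≡ true
  biclique = proj₁ expansion

  between-blocks : ∀ i w → w ≢ m i → count2 s (λ a b → H (combine i a) (combine w b)) ≡ ⟦ A i w ⟧
  between-blocks = proj₁ (proj₂ expansion)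

  external-out : ∀ i a →
    sumFin n (λ w → if does (w ≟ m i) then 0 else count s (λ b → H (combine i a) (combine w b))) ≡ 1
  external-out = proj₁ (proj₂ (proj₂ expansion))

  external-in : ∀ w b →
    sumFin n (λ i → if does (m i ≟ w) then 0 else count s (λ a → H (combine i a) (combine w b))) ≡ 1
  external-in = proj₂ (proj₂ (proj₂ expansion))

  N : ℕ
  N = n * s

  block : Fin N → Fin n
  block = quotient {n} s

  position : Fin N → Fin s
  position = remainder {n} s

  block-combine : ∀ i a → block (combine i a) ≡ i
  block-combine i a = cong proj₁ (remQuot-combine i a)

  combine-block : ∀ x → combine (block x) (position x) ≡ x
  combine-block = combine-remQuot {n} s

  by-blocks : {P : Fin N → Set} → (∀ i a → P (combine i a)) → ∀ x → P x
  by-blocks {P} P-combine x = subst P (combine-block x) (P-combine (block x) (position x))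

  ∑-block : ∀ w (f : Vector ℕ N) → ∑[ y < N ] (δ (block y) w * f y) ≡ ∑[ b < s ] f (combine w b)
  ∑-block w f = begin
    ∑[ y < N ] (δ (block y) w * f y)
      ≡⟨ ∑-combine n s _ ⟩
    ∑[ i < n ] ∑[ b < s ] (δ (block (combine i b)) w * f (combine i b))
      ≡⟨ sum-cong-≗ (λ i → sum-cong-≗ (λ b → cong (λ j → δ j w * f (combine i b)) (block-combine i b))) ⟩
    ∑[ i < n ] ∑[ b < s ] (δ i w * f (combine i b))
      ≡⟨ sum-cong-≗ (λ i → *-distribˡ-sum (δ i w) (f ∘ combine i)) ⟨
    ∑[ i < n ] (δ i w * ∑[ b < s ] f (combine i b))
      ≡⟨ ∑-δ w (λ i → ∑[ b < s ] f (combine i b)) ⟩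
    ∑[ b < s ] f (combine w b)
      ∎
    where open ≡-Reasoning

  block-size : ∀ w → ∑[ y < N ] δ (block y) w ≡ s
  block-size w = begin
    ∑[ y < N ] δ (block y) w        ≡⟨ sum-cong-≗ (λ y → *-identityʳ (δ (block y) w)) ⟨
    ∑[ y < N ] (δ (block y) w * 1)  ≡⟨ ∑-block w (λ _ → 1) ⟩
    ∑[ b < s ] 1                    ≡⟨ trans (∑-const s 1) (*-identityʳ s) ⟩
    s                               ∎
    where open ≡-Reasoning

  external : Fin N → Fin N → Bool
  external x y = H x y ∧ not (does (block y ≟ m (block x)))

  external-combine : ∀ i a w b →
    external (combine i a) (combine w b) ≡ H (combine i a) (combine w b) ∧ not (does (w ≟ m i))
  external-combine i a w b rewrite block-combine i a | block-combine w b = refl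

  biclique-edge : ∀ x y → block y ≡ m (block x) → H x y ≡ true
  biclique-edge x y y∈W[m[x]] = subst₂ (λ x y → H x y ≡ true) (combine-block x) (combine-block y)
    (subst (λ w → H (combine (block x) (position x)) (combine w (position y)) ≡ true)
           (sym y∈W[m[x]]) (biclique (block x) (position x) (position y)))

  ⟦H⟧≡biclique+external : ∀ x y → ⟦ H x y ⟧ ≡ δ (block y) (m (block x)) + ⟦ external x y ⟧
  ⟦H⟧≡biclique+external x y with block y ≟ m (block x)
  ... | no  _           = cong ⟦_⟧ (sym (∧-identityʳ (H x y)))
  ... | yes y∈W[m[x]] =
    trans (cong ⟦_⟧ (biclique-edge x y y∈W[m[x]])) (cong (suc ∘ ⟦_⟧) (sym (∧-zeroʳ (H x y))))

  ∑-external-row : ∀ i a w → ∑[ b < s ] ⟦ external (combine i a) (combine w b) ⟧ ≡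
                   (if does (w ≟ m i) then 0 else count s (λ b → H (combine i a) (combine w b)))
  ∑-external-row i a w = trans (sum-cong-≗ (cong ⟦_⟧ ∘ external-combine i a w))
                               (∑-∧-not (does (w ≟ m i)) (λ b → H (combine i a) (combine w b)))

  ∑-external-column : ∀ w b i → ∑[ a < s ] ⟦ external (combine i a) (combine w b) ⟧ ≡
                      (if does (m i ≟ w) then 0 else count s (λ a → H (combine i a) (combine w b)))
  ∑-external-column w b i = trans (sum-cong-≗ same-test)
                                  (∑-∧-not (does (m i ≟ w)) (λ a → H (combine i a) (combine w b)))
    where
    same-test : ∀ a → ⟦ external (combine i a) (combine w b) ⟧ ≡ ⟦ H (combine i a) (combine w b) ∧ not (does (m i ≟ w)) ⟧
    same-test a = cong ⟦_⟧ (trans (external-combine i a w b)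
                                  (cong (λ c → H (combine i a) (combine w b) ∧ not c) (does-≟-sym w (m i))))

  external-out-degree : ∀ x → ∑[ y < N ] ⟦ external x y ⟧ ≡ 1
  external-out-degree = by-blocks λ i a → begin
    ∑[ y < N ] ⟦ external (combine i a) y ⟧
      ≡⟨ ∑-combine n s _ ⟩
    ∑[ w < n ] ∑[ b < s ] ⟦ external (combine i a) (combine w b) ⟧
      ≡⟨ sum-cong-≗ (∑-external-row i a) ⟩
    ∑[ w < n ] (if does (w ≟ m i) then 0 else count s (λ b → H (combine i a) (combine w b)))
      ≡⟨ trans (sym (sumFin≡∑ n _)) (external-out i a) ⟩
    1 ∎
    where open ≡-Reasoning

  external-in-degree : ∀ y → ∑[ x < N ] ⟦ external x y ⟧ ≡ 1
  external-in-degree = by-blocks λ w b → begin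
    ∑[ x < N ] ⟦ external x (combine w b) ⟧
      ≡⟨ ∑-combine n s _ ⟩
    ∑[ i < n ] ∑[ a < s ] ⟦ external (combine i a) (combine w b) ⟧
      ≡⟨ sum-cong-≗ (∑-external-column w b) ⟩
    ∑[ i < n ] (if does (m i ≟ w) then 0 else count s (λ a → H (combine i a) (combine w b)))
      ≡⟨ trans (sym (sumFin≡∑ n _)) (external-in w b) ⟩
    1 ∎
    where open ≡-Reasoning

  nonMatching : Mat01 n
  nonMatching i w = A i w ∧ not (does (w ≟ m i))

  external-between-blocks : ∀ i w →
    ∑[ a < s ] ∑[ b < s ] ⟦ external (combine i a) (combine w b) ⟧ ≡ ⟦ nonMatching i w ⟧
  external-between-blocks i w = trans (sum-cong-≗ (λ a → ∑-external-row i a w)) (by-case (w ≟ m i))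
    where
    by-case : (d : Dec (w ≡ m i)) →
      ∑[ a < s ] (if does d then 0 else count s (λ b → H (combine i a) (combine w b))) ≡ ⟦ A i w ∧ not (does d) ⟧
    by-case (yes _)      = trans (sum-replicate-zero s) (cong ⟦_⟧ (sym (∧-zeroʳ (A i w))))
    by-case (no  w≢m[i]) = trans (sym (sumFin≡∑ s _))
                                (trans (between-blocks i w w≢m[i]) (cong ⟦_⟧ (sym (∧-identityʳ (A i w)))))

  external⇒edge : ∀ x y → external x y ≡ true → A (block x) (block y) ≡ true
  external⇒edge x y x~y with A (block x) (block y) in A[x,y]
  ... | true  = refl
  ... | false = contradiction (trans (sym one) none) λ ()
    where
    edge : ℕ
    edge = ⟦ external (combine (block x) (position x)) (combine (block y) (position y)) ⟧
    no-edges : ∑[ a < s ] ∑[ b < s ] ⟦ external (combine (block x) a) (combine (block y) b) ⟧ ≡ 0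
    no-edges = trans (external-between-blocks (block x) (block y))
                     (cong (λ c → ⟦ c ∧ not (does (block y ≟ m (block x))) ⟧) A[x,y])
    none : edge ≡ 0
    none = ∑≡0⇒≡0 _ (∑≡0⇒≡0 _ no-edges (position x)) (position y)
    one : edge ≡ 1
    one = cong ⟦_⟧ (trans (cong₂ external (combine-block x) (combine-block y)) x~y)

  mate-unique : ∀ x → ∃! _≡_ (λ y → external x y ≡ true)
  mate-unique x = ∑⟦⟧≡1⇒∃! (external x) (external-out-degree x)

  mate⁻¹-unique : ∀ y → ∃! _≡_ (λ x → external x y ≡ true)
  mate⁻¹-unique y = ∑⟦⟧≡1⇒∃! (λ x → external x y) (external-in-degree y)

  mate : Fin N → Fin N
  mate x = proj₁ (mate-unique x)

  mate⁻¹ : Fin N → Fin N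
  mate⁻¹ y = proj₁ (mate⁻¹-unique y)

  ⟦external⟧≡δ-mate : ∀ x y → ⟦ external x y ⟧ ≡ δ y (mate x)
  ⟦external⟧≡δ-mate x = ∃!⇒⟦⟧≡δ (external x) (mate-unique x)

  ⟦external⟧≡δ-mate⁻¹ : ∀ x y → ⟦ external x y ⟧ ≡ δ x (mate⁻¹ y)
  ⟦external⟧≡δ-mate⁻¹ x y = ∃!⇒⟦⟧≡δ (λ x → external x y) (mate⁻¹-unique y) x

  external-mate : ∀ x → external x (mate x) ≡ true
  external-mate x = proj₁ (proj₂ (mate-unique x))

  mate⁻¹-mate : ∀ x → mate⁻¹ (mate x) ≡ x
  mate⁻¹-mate x = proj₂ (proj₂ (mate⁻¹-unique (mate x))) (external-mate x)

  mate-injective : Injective _≡_ _≡_ mate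
  mate-injective {x} {x'} eq = trans (sym (mate⁻¹-mate x)) (trans (cong mate⁻¹ eq) (mate⁻¹-mate x'))

  H-row-degree : ∀ x → count N (H x) ≡ suc s
  H-row-degree x = begin
    count N (H x)
      ≡⟨ count≡∑ N (H x) ⟩
    ∑[ y < N ] ⟦ H x y ⟧
      ≡⟨ sum-cong-≗ (⟦H⟧≡biclique+external x) ⟩
    ∑[ y < N ] (δ (block y) (m (block x)) + ⟦ external x y ⟧)
      ≡⟨ ∑-distrib-+ (λ y → δ (block y) (m (block x))) (λ y → ⟦ external x y ⟧) ⟩
    ∑[ y < N ] δ (block y) (m (block x)) + ∑[ y < N ] ⟦ external x y ⟧
      ≡⟨ cong₂ _+_ (block-size (m (block x))) (external-out-degree x) ⟩
    s + 1
      ≡⟨ +-comm s 1 ⟩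
    suc s ∎
    where open ≡-Reasoning

  H-column-degree : ∀ y → count N (λ x → H x y) ≡ suc s
  H-column-degree y = begin
    count N (λ x → H x y)
      ≡⟨ count≡∑ N (λ x → H x y) ⟩
    ∑[ x < N ] ⟦ H x y ⟧
      ≡⟨ sum-cong-≗ (λ x → ⟦H⟧≡biclique+external x y) ⟩
    ∑[ x < N ] (δ (block y) (m (block x)) + ⟦ external x y ⟧)
      ≡⟨ ∑-distrib-+ (λ x → δ (block y) (m (block x))) (λ x → ⟦ external x y ⟧) ⟩
    ∑[ x < N ] δ (block y) (m (block x)) + ∑[ x < N ] ⟦ external x y ⟧
      ≡⟨ cong₂ _+_ matched-block (external-in-degree y) ⟩
    s + 1
      ≡⟨ +-comm s 1 ⟩
    suc s ∎
    where
    open ≡-Reasoning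
    matched-block : ∑[ x < N ] δ (block y) (m (block x)) ≡ s
    matched-block with injective⇒surjective m m-injective (block y)
    ... | i , m[i]≡block[y] = trans (sum-cong-≗ λ x → begin
      δ (block y) (m (block x))  ≡⟨ cong (λ w → δ w (m (block x))) m[i]≡block[y] ⟨
      δ (m i) (m (block x))      ≡⟨ δ-injective m-injective i (block x) ⟩
      δ i (block x)              ≡⟨ δ-sym i (block x) ⟩
      δ (block x) i              ∎) (block-size i)

  ∑-mate⁻¹ : ∀ w (g : Vector ℕ n) →
    ∑[ b < s ] g (block (mate⁻¹ (combine w b))) ≡ ∑[ j < n ] (⟦ nonMatching j w ⟧ * g j)
  ∑-mate⁻¹ w g = begin
    ∑[ b < s ] g (block (mate⁻¹ (combine w b)))
      ≡⟨ sum-cong-≗ (λ b → trans (sym (∑-δ (mate⁻¹ (combine w b)) (g ∘ block))) (sum-cong-≗ (by-mate⁻¹ b))) ⟩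
    ∑[ b < s ] ∑[ x < N ] (⟦ external x (combine w b) ⟧ * g (block x))
      ≡⟨ ∑-comm (λ b x → ⟦ external x (combine w b) ⟧ * g (block x)) ⟩
    ∑[ x < N ] ∑[ b < s ] (⟦ external x (combine w b) ⟧ * g (block x))
      ≡⟨ sum-cong-≗ (λ x → *-distribʳ-sum (g (block x)) (λ b → ⟦ external x (combine w b) ⟧)) ⟨
    ∑[ x < N ] (∑[ b < s ] ⟦ external x (combine w b) ⟧ * g (block x))
      ≡⟨ ∑-combine n s _ ⟩
    ∑[ j < n ] ∑[ a < s ] (edges j a * g (block (combine j a)))
      ≡⟨ sum-cong-≗ (λ j → sum-cong-≗ (λ a → cong (λ i → edges j a * g i) (block-combine j a))) ⟩
    ∑[ j < n ] ∑[ a < s ] (edges j a * g j)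
      ≡⟨ sum-cong-≗ (λ j → trans (sym (*-distribʳ-sum (g j) (edges j)))
                                 (cong (_* g j) (external-between-blocks j w))) ⟩
    ∑[ j < n ] (⟦ nonMatching j w ⟧ * g j)
      ∎
    where
    open ≡-Reasoning
    by-mate⁻¹ : ∀ b x → δ x (mate⁻¹ (combine w b)) * g (block x) ≡ ⟦ external x (combine w b) ⟧ * g (block x)
    by-mate⁻¹ b x = cong (_* g (block x)) (sym (⟦external⟧≡δ-mate⁻¹ x (combine w b)))
    edges : Fin n → Fin s → ℕ
    edges j a = ∑[ b < s ] ⟦ external (combine j a) (combine w b) ⟧

  nonMatching+δ : ∀ i j → ⟦ nonMatching j (m i) ⟧ + δ j i ≡ ⟦ A j (m i) ⟧
  nonMatching+δ i j with j ≟ i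
  ... | yes refl rewrite m-edge j = cong (_+ 1) (J∸I-diagonal (m j))
  ... | no  j≢i with m i ≟ m j
  ...   | yes m[i]≡m[j] = contradiction (m-injective (sym m[i]≡m[j])) j≢i
  ...   | no  _         = trans (+-identityʳ _) (cong ⟦_⟧ (∧-identityʳ (A j (m i))))

  module Certificate (B : Mat01 n)
    (ABᵀ≡J∸I : ∀ i j → (⟪ A ⟫ · ⟪ B ⟫ ᵀ) i j ≡ J∸I i j)
    (BᵀA≡J∸I : ∀ i j → (⟪ B ⟫ ᵀ · ⟪ A ⟫) i j ≡ J∸I i j)
    where

    A⇒¬B : ∀ {j l} → A j l ≡ true → B j l ≡ false
    A⇒¬B {j} {l} A[j,l] = ⟦⟧≡0⇒false (trans (sym (+-identityʳ ⟦ B j l ⟧))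
      (subst (λ a → ⟦ a ⟧ * ⟦ B j l ⟧ ≡ 0) A[j,l]
        (∑≡0⇒≡0 (λ l → ⟦ A j l ⟧ * ⟦ B j l ⟧) (trans (ABᵀ≡J∸I j j) (J∸I-diagonal j)) l)))

    B' : Mat01 N
    B' x' y = does (y ≟ mate x') ∨ B (block (mate⁻¹ y)) (block (mate x'))

    ⟦B'⟧≡mate+B : ∀ x' y → ⟦ B' x' y ⟧ ≡ δ y (mate x') + ⟦ B (block (mate⁻¹ y)) (block (mate x')) ⟧
    ⟦B'⟧≡mate+B x' y with y ≟ mate x'
    ... | no  _    = refl
    ... | yes refl rewrite mate⁻¹-mate x' | A⇒¬B (external⇒edge x' (mate x') (external-mate x')) = refl

    nonMatching-column : ∀ i t → ∑[ j < n ] (⟦ nonMatching j (m i) ⟧ * ⟦ B j t ⟧) + ⟦ B i t ⟧ ≡ J∸I t (m i)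
    nonMatching-column i t = begin
      ∑[ j < n ] (⟦ nonMatching j (m i) ⟧ * ⟦ B j t ⟧) + ⟦ B i t ⟧
        ≡⟨ cong (∑[ j < n ] (⟦ nonMatching j (m i) ⟧ * ⟦ B j t ⟧) +_) (∑-δ i (λ j → ⟦ B j t ⟧)) ⟨
      ∑[ j < n ] (⟦ nonMatching j (m i) ⟧ * ⟦ B j t ⟧) + ∑[ j < n ] (δ j i * ⟦ B j t ⟧)
        ≡⟨ ∑-distrib-+ (λ j → ⟦ nonMatching j (m i) ⟧ * ⟦ B j t ⟧) (λ j → δ j i * ⟦ B j t ⟧) ⟨
      ∑[ j < n ] (⟦ nonMatching j (m i) ⟧ * ⟦ B j t ⟧ + δ j i * ⟦ B j t ⟧)
        ≡⟨ sum-cong-≗ merge ⟩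
      (⟪ B ⟫ ᵀ · ⟪ A ⟫) t (m i)
        ≡⟨ BᵀA≡J∸I t (m i) ⟩
      J∸I t (m i)
        ∎
      where
      open ≡-Reasoning
      merge : ∀ j → ⟦ nonMatching j (m i) ⟧ * ⟦ B j t ⟧ + δ j i * ⟦ B j t ⟧ ≡ ⟦ B j t ⟧ * ⟦ A j (m i) ⟧
      merge j = begin
        ⟦ nonMatching j (m i) ⟧ * ⟦ B j t ⟧ + δ j i * ⟦ B j t ⟧  ≡⟨ *-distribʳ-+ ⟦ B j t ⟧ ⟦ nonMatching j (m i) ⟧ (δ j i) ⟨
        (⟦ nonMatching j (m i) ⟧ + δ j i) * ⟦ B j t ⟧            ≡⟨ cong (_* ⟦ B j t ⟧) (nonMatching+δ i j) ⟩
        ⟦ A j (m i) ⟧ * ⟦ B j t ⟧                                ≡⟨ *-comm ⟦ A j (m i) ⟧ ⟦ B j t ⟧ ⟩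
        ⟦ B j t ⟧ * ⟦ A j (m i) ⟧                                ∎

    H·B'ᵀ≡J+I : ∀ x x' → (⟪ H ⟫ · ⟪ B' ⟫ ᵀ) x x' ≡ 1 + δ x x'
    H·B'ᵀ≡J+I x x' = begin
      ∑[ y < N ] (⟦ H x y ⟧ * ⟦ B' x' y ⟧)
        ≡⟨ sum-cong-≗ (λ y → cong₂ _*_ (trans (⟦H⟧≡biclique+external x y) (cong (D y +_) (⟦external⟧≡δ-mate x y)))
                                       (⟦B'⟧≡mate+B x' y)) ⟩
      ∑[ y < N ] ((D y + δ y (mate x)) * (δ y (mate x') + T y))
        ≡⟨ ∑-expand D (λ y → δ y (mate x)) (λ y → δ y (mate x')) T ⟩
      ∑[ y < N ] (D y * δ y (mate x')) + ∑[ y < N ] (D y * T y)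
        + (∑[ y < N ] (δ y (mate x) * δ y (mate x')) + ∑[ y < N ] (δ y (mate x) * T y))
        ≡⟨ cong₂ _+_ (cong₂ _+_ biclique-mate biclique-certificate) (cong₂ _+_ mate-mate mate-certificate) ⟩
      δ t (m i) + X + (δ x x' + ⟦ B i t ⟧)
        ≡⟨ regroup (δ t (m i)) X (δ x x') ⟦ B i t ⟧ ⟩
      δ t (m i) + (X + ⟦ B i t ⟧) + δ x x'
        ≡⟨ cong (λ z → δ t (m i) + z + δ x x') (nonMatching-column i t) ⟩
      δ t (m i) + J∸I t (m i) + δ x x'
        ≡⟨ cong (_+ δ x x') (trans (+-comm (δ t (m i)) _) (J∸I+δ t (m i))) ⟩
      1 + δ x x'
        ∎
      where
      open ≡-Reasoning
      i : Fin n
      i = block x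
      t : Fin n
      t = block (mate x')
      D : Vector ℕ N
      D y = δ (block y) (m i)
      T : Vector ℕ N
      T y = ⟦ B (block (mate⁻¹ y)) t ⟧
      X : ℕ
      X = ∑[ j < n ] (⟦ nonMatching j (m i) ⟧ * ⟦ B j t ⟧)
      biclique-mate : ∑[ y < N ] (D y * δ y (mate x')) ≡ δ t (m i)
      biclique-mate = ∑-δʳ (mate x') D
      biclique-certificate : ∑[ y < N ] (D y * T y) ≡ X
      biclique-certificate = trans (∑-block (m i) T) (∑-mate⁻¹ (m i) (λ j → ⟦ B j t ⟧))
      mate-mate : ∑[ y < N ] (δ y (mate x) * δ y (mate x')) ≡ δ x x'
      mate-mate = trans (∑-δ (mate x) (λ y → δ y (mate x'))) (δ-injective mate-injective x x')
      mate-certificate : ∑[ y < N ] (δ y (mate x) * T y) ≡ ⟦ B i t ⟧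
      mate-certificate = trans (∑-δ (mate x) T) (cong (λ z → ⟦ B (block z) t ⟧) (mate⁻¹-mate x))
      regroup : ∀ a b c d → a + b + (c + d) ≡ a + (b + d) + c
      regroup = solve-∀

-- Imported only here: its prefix operator +_ would make the ℕ sections (a +_) above ambiguous.
open import Data.Integer using (+_; -[1+_]) renaming (_+_ to _+ℤ_)
import Data.Integer.Properties as ℤ

J-I-entry : ∀ c → (if c then + 1 +ℤ -[1+ 0 ] else + 1) ≡ + ⟦ not c ⟧
J-I-entry true  = refl
J-I-entry false = refl

J+I-entry : ∀ c → + (1 + ⟦ c ⟧) ≡ (if c then + 1 +ℤ + 1 else + 1)
J+I-entry true  = refl
J+I-entry false = refl

biclique-expansion-isLehman : ∀ {n s} (A : Mat01 n) (m : Fin n → Fin n) (H : Mat01 (n * s)) → 2 ≤ n →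
  IsLehman n (suc s) -[1+ 0 ] A → IsPerfectMatching n A m → IsBicliqueExpansion n (suc s) A m H →
  IsLehman (n * s) (suc s) (+ 1) H
biclique-expansion-isLehman A m H 2≤n (regular , _ , B , AB≡J-I) matching expansion =
  (H-row-degree , H-column-degree) , inj₂ ℤ.≤-refl , B' , λ x x' →
    trans (cong +_ (trans (prodT≡· H B' x x') (H·B'ᵀ≡J+I x x'))) (J+I-entry (does (x ≟ x')))
  where
  ABᵀ≡J∸I : ∀ i j → (⟪ A ⟫ · ⟪ B ⟫ ᵀ) i j ≡ J∸I i j
  ABᵀ≡J∸I i j = trans (sym (prodT≡· A B i j)) (ℤ.+-injective (trans (AB≡J-I i j) (J-I-entry (does (i ≟ j)))))
  BᵀA≡J∸I : ∀ l w → (⟪ B ⟫ ᵀ · ⟪ A ⟫) l w ≡ J∸I l w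
  BᵀA≡J∸I = ·ᵀ≡J∸I⇒ᵀ·≡J∸I A B 2≤n regular ABᵀ≡J∸I
  open BicliqueExpansion A m H matching expansion
  open Certificate B ABᵀ≡J∸I BᵀA≡J∸I

isLehman-empty : ∀ {N} r (H : Mat01 N) → ¬ Fin N → IsLehman N r (+ 1) H
isLehman-empty r H ¬x = ((λ x → contradiction x ¬x) , (λ y → contradiction y ¬x)) , inj₂ ℤ.≤-refl , H ,
  λ x → contradiction x ¬x

¬Fin[n*0] : ∀ n → ¬ Fin (n * 0)
¬Fin[n*0] n x with subst Fin (*-zeroʳ n) x
... | ()

lemma4p6 : (n r : ℕ) (A : Mat01 n) → IsLehman n r -[1+ 0 ] A →
    (m : Fin n → Fin n) → IsPerfectMatching n A m →
    (H : Mat01 (n * (r ∸ 1))) → IsBicliqueExpansion n r A m H →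
    IsLehman (n * (r ∸ 1)) r (+ 1) H
lemma4p6 n             zero          A _ m _ H _ = isLehman-empty zero H (¬Fin[n*0] n)
lemma4p6 zero          (suc s)       A _ m _ H _ = isLehman-empty (suc s) H λ ()
lemma4p6 (suc zero)    (suc zero)    A _ m _ H _ = isLehman-empty 1 H λ ()
lemma4p6 (suc zero)    (suc (suc r)) A ((rows , _) , _) m _ H _ =
  contradiction (subst (_≤ 1) (rows zero) (count≤n 1 (A zero))) λ { (s≤s ()) }
lemma4p6 (suc (suc n)) (suc s)       A lehman m matching H expansion =
  biclique-expansion-isLehman A m H (s≤s (s≤s z≤n)) lehman matching expansion
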